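{- Let $n\ge 3$, let $1\le t\le n-2$, and let $q$ be a product of $k\ge1$ pairwise distinct primes. Then $$\mathrm{DI}(\mathbf{ETHR}_n^t,q)\ge \frac{\max\{n-t+2,\;t+2\}}{k}\ge \frac{n/2+2}{k}.$$
   Context: For a predicate $P:\mathcal X\times\mathcal Y\to\{0,1\}$ (finite sets) and integer $q\ge2$, an inner product encoding of $P$ modulo $q$ of length $\ell$ is a pair of maps $x\mapsto \vec x\in\mathbb Z_q^\ell$, $y\mapsto\vec y\in\mathbb Z_q^\ell$ such that for all $x,y$: $P(x,y)=1$ iff $\sum_{i=1}^\ell\vec x_i\vec y_i\equiv0\pmod q$; $\mathrm{DI}(P,q)$ is the minimum such $\ell$. For $t\in[n]$, the exact threshold predicate $\mathbf{ETHR}_n^t:2^{[n]}\times2^{[n]}\to\{0,1\}$ is $\mathbf{ETHR}_n^t(S,T)=1$ iff $|S\cap T|=t$. -}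

module Defs where

open import Level using (_⊔_)
open import Data.Nat using (ℕ; zero; suc; _+_; _*_; _≡ᵇ_)
open import Data.Nat.Divisibility using (_∣_)
open import Data.Bool using (Bool; true)
open import Data.Fin using (Fin; toℕ)
open import Data.Fin.Subset using (Subset; _∩_; ∣_∣)
open import Data.Vec using (Vec; zipWith; foldr)
open import Data.Product using (Σ; _×_)
open import Relation.Binary.PropositionalEquality using (_≡_)
open import Function.Bundles using (_⇔_)

-- Inner product of two vectors over Z_q, computed on the canonical
-- representatives in ℕ (reduction mod q happens in the divisibility test).
innerProduct : ∀ {q ℓ} → Vec (Fin q) ℓ → Vec (Fin q) ℓ → ℕ
innerProduct u v = foldr _ _+_ 0 (zipWith (λ a b → toℕ a * toℕ b) u v)

IPEncoding : ∀ {a b} {X : Set a} {Y : Set b} →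
             (X → Y → Bool) → (q ℓ : ℕ) → Set (a ⊔ b)
IPEncoding {X = X} {Y = Y} P q ℓ =
  Σ (X → Vec (Fin q) ℓ) λ f → Σ (Y → Vec (Fin q) ℓ) λ g →
    ∀ x y → (P x y ≡ true) ⇔ (q ∣ innerProduct (f x) (g y))

ETHR : (n t : ℕ) → Subset n → Subset n → Bool
ETHR n t S T = ∣ S ∩ T ∣ ≡ᵇ t

-- A triangular family for a relation R is a list of pairs (xᵢ, yᵢ) with R xᵢ yⱼ for i < j
-- and ¬ R xᵢ yᵢ (a one-sided fooling set). An inner product encoding modulo q of length ℓ
-- turns a triangular family for P into one for "q divides ⟨x, y⟩" over ℤ^ℓ. If q is a
-- product of k distinct primes, splitting the pairs according to whether the first prime p
-- divides ⟨xᵢ, yᵢ⟩ reduces to families that are triangular modulo p and modulo q / p, and a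
-- family that is triangular modulo a prime p has at most ℓ members: the first x has a
-- coordinate r with p ∤ xᵣ, and eliminating r from the remaining pairs (a ↦ xᵣ a − aᵣ x,
-- then dropping coordinate r) leaves a triangular family in dimension ℓ − 1. For ETHR with
-- threshold t there are triangular families of sizes t + 2, namely the pairs (∁{i}, ∁{i})
-- for i in a block of t + 2 points, and n − t + 2, namely (all, B) and (B ∪ ∁{i}, B ∪ {i})
-- where B is a block of t − 1 points and i ranges over the remaining n − t + 1 points.

module Submission where

open import Defs
open import Level using (Level)
open import Data.Bool using (Bool; true; false; not; T)
open import Data.Bool.Properties using (T-≡)
open import Data.Nat as ℕ using (ℕ; zero; suc; _∸_; _⊔_; _≤_; z≤n; s≤s)
open import Data.Nat.Properties
  using (+-comm; +-suc; +-identityʳ; +-cancelˡ-≡; 1+n≢n; ≤-trans; +-mono-≤; m≤m⊔n; m≤n⊔m; ⊔-lub;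
         m+[n∸m]≡n; m∸n+n≡m; m≤o∸n⇒m+n≤o; m+n≤o⇒m≤o; ≡ᵇ⇒≡; ≡⇒≡ᵇ; module ≤-Reasoning)
import Data.Nat.Tactic.RingSolver as ℕ-Solver
open import Data.Nat.Divisibility using (_∣_; _∤_; divides; m∣m*n; n∣m*n; ∣1⇒≡1; *-monoˡ-∣; 1∣_; _∣0)
open import Data.Nat.Primality using (Prime; euclidsLemma; ¬prime[1]; prime⇒irreducible)
open import Data.Nat.ListAction using (product)
open import Data.Integer as ℤ using (ℤ; 0ℤ)
open import Data.Integer.Properties as ℤ using (abs-*; pos-*; pos-+)
open import Data.Integer.Divisibility.Signed as ℤ
  using (∣ᵤ⇒∣; ∣⇒∣ᵤ; ∣-trans; ∣m∣n⇒∣m+n; ∣m∣n⇒∣m-n; ∣m+n∣n⇒∣m; ∣m⇒∣-m; ∣m⇒∣m*n; ∣n⇒∣m*n)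
open import Data.Integer.Tactic.RingSolver using (solve-∀)
open import Data.Fin using (Fin; zero; suc; toℕ)
open import Data.Fin.Properties using (¬∀⟶∃¬)
open import Data.Fin.Subset using (Subset; inside; outside; ⊤; ⊥; ⁅_⁆; ∁; _∩_; ∣_∣)
open import Data.Fin.Subset.Properties
  using (∣⊤∣≡n; ∣⊥∣≡0; ∣⁅x⁆∣≡1; ∣∁p∣≡n∸∣p∣; ∩-idem; ∩-identityˡ; ∩-identityʳ; ∩-zeroʳ; ∩-inverseˡ)
open import Data.Vec using (Vec; []; _∷_; _++_; lookup)
open import Data.Vec.Properties using (map-replicate)
open import Data.Vec.Functional using (Vector; removeAt)
open import Data.List using (List; []; _∷_; length; map; filter; tabulate)
open import Data.List.Properties using (length-map; length-tabulate)
open import Data.List.Membership.Propositional using (_∉_)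
open import Data.List.Relation.Unary.Any using (here; there)
open import Data.List.Relation.Unary.All as All using (All; []; _∷_)
open import Data.List.Relation.Unary.All.Properties as All using (All¬⇒¬Any; all-filter)
open import Data.List.Relation.Unary.AllPairs as AllPairs using (AllPairs; []; _∷_)
import Data.List.Relation.Unary.AllPairs.Properties as AllPairs
open import Data.List.Relation.Unary.Unique.Propositional using (Unique)
open import Data.Product as Product using (Σ; ∃; _×_; _,_; proj₂)
open import Data.Sum as Sum using (_⊎_; inj₁; inj₂)
open import Function using (_∘_; _⇔_; mk⇔; Equivalence)
import Function.Properties.Equivalence as ⇔
open import Relation.Nullary using (¬_; does; contradiction)
open import Relation.Unary using (Pred; Decidable; U)
open import Relation.Unary.Properties using (∁?)
open import Relation.Binary.PropositionalEquality
  using (_≡_; _≢_; refl; sym; trans; cong; cong₂; subst; subst₂; module ≡-Reasoning)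

open import Algebra.Properties.CommutativeMonoid.Sum ℤ.+-0-commutativeMonoid using (sum; sum-remove)

private
  variable
    a b c : Level
    A A′ : Set a
    B B′ : Set b
    ℓ : ℕ

Triangular : (A → B → Set c) → List (A × B) → Set _
Triangular R L = All (λ (x , y) → ¬ R x y) L × AllPairs (λ (x , _) (_ , y) → R x y) L

TriangularFamily : (A → B → Set c) → ℕ → Set _
TriangularFamily {A = A} {B = B} R k = Σ (List (A × B)) λ L → length L ≡ k × Triangular R L

Triangular-map : {R : A → B → Set c} {R′ : A′ → B′ → Set c} {Q : Pred B c} {L : List (A × B)}
  (f : A → A′) (g : B → B′) → All (Q ∘ proj₂) L →
  (∀ x y → Q y → R x y ⇔ R′ (f x) (g y)) →
  Triangular R L → Triangular R′ (map (Product.map f g) L)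
Triangular-map f g [] R⇔R′ ([] , []) = [] , []
Triangular-map f g (q ∷ qs) R⇔R′ (¬r ∷ ¬rs , rs ∷ rss) =
  let ¬rs′ , rss′ = Triangular-map f g qs R⇔R′ (¬rs , rss) in
  ¬r ∘ Equivalence.from (R⇔R′ _ _ q) ∷ ¬rs′ ,
  All.map⁺ (All.zipWith (λ (q , r) → Equivalence.to (R⇔R′ _ _ q) r) (qs , rs)) ∷ rss′

Triangular-filter : {R R′ : A → B → Set c} {P : Pred (A × B) c} (P? : Decidable P) {L : List (A × B)} →
  (∀ {x y} → R x y → R′ x y) → (∀ {x y} → P (x , y) → ¬ R x y → ¬ R′ x y) →
  Triangular R L → Triangular R′ (filter P? L)
Triangular-filter P? {L} R⇒R′ ¬R⇒¬R′ (¬rs , rs) =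
  All.zipWith (λ (p , ¬r) → ¬R⇒¬R′ p ¬r) (all-filter P? L , All.filter⁺ P? ¬rs) ,
  AllPairs.map R⇒R′ (AllPairs.filter⁺ P? rs)

length-filter-∁+length-filter : {P : Pred A c} (P? : Decidable P) (xs : List A) →
  length (filter (∁? P?) xs) ℕ.+ length (filter P? xs) ≡ length xs
length-filter-∁+length-filter P? [] = refl
length-filter-∁+length-filter P? (x ∷ xs) with does (P? x)
... | true = trans (+-suc _ _) (cong suc (length-filter-∁+length-filter P? xs))
... | false = cong suc (length-filter-∁+length-filter P? xs)

module _ where
  open import Data.Integer using (+_; _+_; _*_; _-_)

  infix 7 _·_

  _·_ : Vector ℤ ℓ → Vector ℤ ℓ → ℤ
  u · v = sum (λ i → u i * v i)

  _⊥[_]_ : Vector ℤ ℓ → ℕ → Vector ℤ ℓ → Set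
  x ⊥[ d ] y = + d ℤ.∣ x · y

  ·-linearˡ : ∀ (α β : ℤ) (u v w : Vector ℤ ℓ) →
    (λ i → α * u i - β * v i) · w ≡ α * (u · w) - β * (v · w)
  ·-linearˡ {zero} α β u v w = zero-identity α β
    where
    zero-identity : ∀ α β → 0ℤ ≡ α * 0ℤ - β * 0ℤ
    zero-identity = solve-∀
  ·-linearˡ {suc ℓ} α β u v w = begin
    (α * u zero - β * v zero) * w zero + (λ i → α * u (suc i) - β * v (suc i)) · (w ∘ suc)
      ≡⟨ cong (λ s → (α * u zero - β * v zero) * w zero + s) (·-linearˡ α β (u ∘ suc) (v ∘ suc) (w ∘ suc)) ⟩
    (α * u zero - β * v zero) * w zero + (α * ((u ∘ suc) · (w ∘ suc)) - β * ((v ∘ suc) · (w ∘ suc)))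
      ≡⟨ distrib α β (u zero) (v zero) (w zero) _ _ ⟩
    α * (u · w) - β * (v · w) ∎
    where
    open ≡-Reasoning
    distrib : ∀ α β x y z X Y → (α * x - β * y) * z + (α * X - β * Y) ≡ α * (x * z + X) - β * (y * z + Y)
    distrib = solve-∀

  removeAt-· : ∀ (u v : Vector ℤ (suc ℓ)) r → u r ≡ 0ℤ → removeAt u r · removeAt v r ≡ u · v
  removeAt-· u v r uᵣ≡0 = begin
    removeAt u r · removeAt v r            ≡⟨ sym (ℤ.+-identityˡ _) ⟩
    0ℤ + removeAt u r · removeAt v r       ≡⟨ cong (λ z → z * v r + removeAt u r · removeAt v r) (sym uᵣ≡0) ⟩
    u r * v r + removeAt u r · removeAt v r  ≡⟨ sym (sum-remove {i = r} (λ i → u i * v i)) ⟩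
    u · v                                  ∎
    where open ≡-Reasoning

  ∣-· : ∀ {k} (u v : Vector ℤ ℓ) → (∀ i → k ℤ.∣ u i) → k ℤ.∣ u · v
  ∣-· {zero} u v k∣u = ∣ᵤ⇒∣ (_ ∣0)
  ∣-· {suc ℓ} u v k∣u = ∣m∣n⇒∣m+n (∣m⇒∣m*n (v zero) (k∣u zero)) (∣-· (u ∘ suc) (v ∘ suc) (k∣u ∘ suc))

  clear : Vector ℤ ℓ → Fin ℓ → Vector ℤ ℓ → Vector ℤ ℓ
  clear x r a i = x r * a i - a r * x i

  eliminate : Vector ℤ (suc ℓ) → Fin (suc ℓ) → Vector ℤ (suc ℓ) → Vector ℤ ℓ
  eliminate x r a = removeAt (clear x r a) r

  eliminate-· : ∀ x r a (b : Vector ℤ (suc ℓ)) →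
    eliminate x r a · removeAt b r ≡ x r * (a · b) - a r * (x · b)
  eliminate-· x r a b =
    trans (removeAt-· (clear x r a) b r (cancel (x r) (a r))) (·-linearˡ (x r) (a r) a x b)
    where
    cancel : ∀ u v → u * v - v * u ≡ 0ℤ
    cancel = solve-∀

  euclidsLemmaℤ : ∀ {p} → Prime p → ∀ {m n} → + p ℤ.∣ m * n → + p ℤ.∣ m ⊎ + p ℤ.∣ n
  euclidsLemmaℤ p-prime {m} {n} p∣mn =
    Sum.map ∣ᵤ⇒∣ ∣ᵤ⇒∣ (euclidsLemma _ _ p-prime (subst (_ ∣_) (abs-* m n) (∣⇒∣ᵤ p∣mn)))

  eliminate-⊥⇔ : ∀ {p} → Prime p → ∀ (x : Vector ℤ (suc ℓ)) r → ¬ + p ℤ.∣ x r →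
    ∀ a b → x ⊥[ p ] b → a ⊥[ p ] b ⇔ eliminate x r a ⊥[ p ] removeAt b r
  eliminate-⊥⇔ {p = p} p-prime x r p∤xᵣ a b x⊥b = mk⇔ preserve reflect
    where
    p∣aᵣ[x·b] : + p ℤ.∣ a r * (x · b)
    p∣aᵣ[x·b] = ∣n⇒∣m*n (a r) x⊥b
    preserve : a ⊥[ p ] b → eliminate x r a ⊥[ p ] removeAt b r
    preserve a⊥b = subst (+ p ℤ.∣_) (sym (eliminate-· x r a b)) (∣m∣n⇒∣m-n (∣n⇒∣m*n (x r) a⊥b) p∣aᵣ[x·b])
    reflect : eliminate x r a ⊥[ p ] removeAt b r → a ⊥[ p ] b
    reflect h
      with euclidsLemmaℤ p-prime (∣m+n∣n⇒∣m (subst (+ p ℤ.∣_) (eliminate-· x r a b) h) (∣m⇒∣-m p∣aᵣ[x·b]))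
    ... | inj₁ p∣xᵣ = contradiction p∣xᵣ p∤xᵣ
    ... | inj₂ p∣a·b = p∣a·b

  pivot : ∀ {d} (x y : Vector ℤ ℓ) → ¬ x ⊥[ d ] y → ∃ λ r → ¬ + d ℤ.∣ x r
  pivot {ℓ} x y ¬x⊥y = ¬∀⟶∃¬ ℓ _ (λ i → _ ℤ.∣? x i) (λ d∣x → ¬x⊥y (∣-· x y d∣x))

  triangular-length≤ : ∀ {p} → Prime p → (L : List (Vector ℤ ℓ × Vector ℤ ℓ)) →
    Triangular _⊥[ p ]_ L → length L ≤ ℓ
  triangular-length≤ p-prime [] _ = z≤n
  triangular-length≤ {zero} p-prime ((x , y) ∷ L) (¬x⊥y ∷ _ , _) = contradiction (∣ᵤ⇒∣ (_ ∣0)) ¬x⊥y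
  triangular-length≤ {suc ℓ} p-prime ((x , y) ∷ L) (¬x⊥y ∷ ¬L , x⊥L ∷ L-tri) =
    let r , p∤xᵣ = pivot x y ¬x⊥y
        drop = λ b → removeAt b r
        project = Product.map (eliminate x r) drop
    in s≤s (subst (_≤ ℓ) (length-map project L)
         (triangular-length≤ p-prime (map project L)
           (Triangular-map (eliminate x r) drop x⊥L (eliminate-⊥⇔ p-prime x r p∤xᵣ) (¬L , L-tri))))

open import Data.Nat using (_+_; _*_)

prime∤product : ∀ {p ps} → Prime p → All Prime ps → p ∉ ps → p ∤ product ps
prime∤product p-prime [] _ p∣1 = ¬prime[1] (subst Prime (∣1⇒≡1 p∣1) p-prime)
prime∤product p-prime (q-prime ∷ primes) p∉q∷ps p∣qQ with euclidsLemma _ _ p-prime p∣qQ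
... | inj₂ p∣Q = prime∤product p-prime primes (p∉q∷ps ∘ there) p∣Q
... | inj₁ p∣q with prime⇒irreducible q-prime p∣q
...   | inj₁ p≡1 = ¬prime[1] (subst Prime p≡1 p-prime)
...   | inj₂ p≡q = p∉q∷ps (here p≡q)

p∣n∧m∣n⇒p*m∣n : ∀ {p m n} → Prime p → p ∤ m → p ∣ n → m ∣ n → p * m ∣ n
p∣n∧m∣n⇒p*m∣n {m = m} p-prime p∤m p∣n (divides c refl) with euclidsLemma c m p-prime p∣n
... | inj₁ p∣c = *-monoˡ-∣ m p∣c
... | inj₂ p∣m = contradiction p∣m p∤m

triangular-length≤-squarefree : ∀ {ps} → All Prime ps → Unique ps →
  (L : List (Vector ℤ ℓ × Vector ℤ ℓ)) → Triangular _⊥[ product ps ]_ L → length L ≤ length ps * ℓ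
triangular-length≤-squarefree [] [] [] _ = z≤n
triangular-length≤-squarefree [] [] (_ ∷ _) (¬x⊥y ∷ _ , _) = contradiction (∣ᵤ⇒∣ (1∣ _)) ¬x⊥y
triangular-length≤-squarefree {ℓ} {p ∷ ps} (p-prime ∷ primes) (p∉ps ∷ unique) L tri = begin
  length L
    ≡⟨ sym (length-filter-∁+length-filter divisible? L) ⟩
  length (filter (∁? divisible?) L) + length (filter divisible? L)
    ≤⟨ +-mono-≤ (triangular-length≤ p-prime _ mod-p) (triangular-length≤-squarefree primes unique _ mod-Q) ⟩
  ℓ + length ps * ℓ
    ∎
  where
  open ≤-Reasoning
  Q = product ps
  p∤Q : p ∤ Q
  p∤Q = prime∤product p-prime primes (All¬⇒¬Any p∉ps)
  divisible? : Decidable {A = Vector ℤ ℓ × Vector ℤ ℓ} (λ (x , y) → x ⊥[ p ] y)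
  divisible? (x , y) = ℤ.+ p ℤ.∣? x · y
  mod-p : Triangular _⊥[ p ]_ (filter (∁? divisible?) L)
  mod-p = Triangular-filter (∁? divisible?) (ℤ.∣-trans (∣ᵤ⇒∣ (m∣m*n Q))) (λ p∤ _ → p∤) tri
  mod-Q : Triangular _⊥[ Q ]_ (filter divisible? L)
  mod-Q = Triangular-filter divisible? (ℤ.∣-trans (∣ᵤ⇒∣ (n∣m*n p)))
    (λ p∣ ¬pQ∣ Q∣ → ¬pQ∣ (∣ᵤ⇒∣ (p∣n∧m∣n⇒p*m∣n p-prime p∤Q (∣⇒∣ᵤ p∣) (∣⇒∣ᵤ Q∣)))) tri

toℤ : ∀ {q} → Vec (Fin q) ℓ → Vector ℤ ℓ
toℤ v i = ℤ.+ toℕ (lookup v i)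

toℤ-· : ∀ {q} (u v : Vec (Fin q) ℓ) → toℤ u · toℤ v ≡ ℤ.+ innerProduct u v
toℤ-· [] [] = refl
toℤ-· (a ∷ u) (b ∷ v) =
  trans (cong₂ ℤ._+_ (sym (pos-* (toℕ a) (toℕ b))) (toℤ-· u v)) (sym (pos-+ (toℕ a * toℕ b) _))

∣innerProduct⇔ : ∀ {q d} (u v : Vec (Fin q) ℓ) → d ∣ innerProduct u v ⇔ toℤ u ⊥[ d ] toℤ v
∣innerProduct⇔ u v rewrite toℤ-· u v = mk⇔ ∣ᵤ⇒∣ ∣⇒∣ᵤ

Holds : {X : Set a} {Y : Set b} → (X → Y → Bool) → X → Y → Set
Holds P x y = T (P x y)

IPEncoding⇒length≤ : {X : Set a} {Y : Set b} {P : X → Y → Bool} {ps : List ℕ} →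
  All Prime ps → Unique ps → IPEncoding P (product ps) ℓ →
  (L : List (X × Y)) → Triangular (Holds P) L → length L ≤ length ps * ℓ
IPEncoding⇒length≤ {P = P} {ps} primes unique (f , g , P⇔q∣) L tri =
  subst (_≤ _) (length-map encode L)
    (triangular-length≤-squarefree primes unique (map encode L)
      (Triangular-map (toℤ ∘ f) (toℤ ∘ g) (All.universal-U L) encodes tri))
  where
  encode = Product.map (toℤ ∘ f) (toℤ ∘ g)
  encodes : ∀ x y → U y → Holds P x y ⇔ toℤ (f x) ⊥[ product ps ] toℤ (g y)
  encodes x y _ = ⇔.trans T-≡ (⇔.trans (P⇔q∣ x y) (∣innerProduct⇔ (f x) (g y)))

∣p++q∩r++s∣≡∣p∩r∣+∣q∩s∣ : ∀ {m k} (p : Subset m) (q : Subset k) (r : Subset m) (s : Subset k) →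
  ∣ (p ++ q) ∩ (r ++ s) ∣ ≡ ∣ p ∩ r ∣ + ∣ q ∩ s ∣
∣p++q∩r++s∣≡∣p∩r∣+∣q∩s∣ [] q [] s = refl
∣p++q∩r++s∣≡∣p∩r∣+∣q∩s∣ (inside ∷ p) q (inside ∷ r) s = cong suc (∣p++q∩r++s∣≡∣p∩r∣+∣q∩s∣ p q r s)
∣p++q∩r++s∣≡∣p∩r∣+∣q∩s∣ (inside ∷ p) q (outside ∷ r) s = ∣p++q∩r++s∣≡∣p∩r∣+∣q∩s∣ p q r s
∣p++q∩r++s∣≡∣p∩r∣+∣q∩s∣ (outside ∷ p) q (_ ∷ r) s = ∣p++q∩r++s∣≡∣p∩r∣+∣q∩s∣ p q r s

∁⊥≡⊤ : ∀ {n} → ∁ (⊥ {n}) ≡ ⊤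
∁⊥≡⊤ {n} = map-replicate not outside n

∣∁⊥∩p∣≡∣p∣ : ∀ {n} (p : Subset n) → ∣ ∁ ⊥ ∩ p ∣ ≡ ∣ p ∣
∣∁⊥∩p∣≡∣p∣ p = cong ∣_∣ (trans (cong (_∩ p) ∁⊥≡⊤) (∩-identityˡ p))

∣p∩∁⊥∣≡∣p∣ : ∀ {n} (p : Subset n) → ∣ p ∩ ∁ ⊥ ∣ ≡ ∣ p ∣
∣p∩∁⊥∣≡∣p∣ p = cong ∣_∣ (trans (cong (p ∩_) ∁⊥≡⊤) (∩-identityʳ p))

1+∣∁⁅x⁆∣≡n : ∀ {n} (x : Fin n) → suc ∣ ∁ ⁅ x ⁆ ∣ ≡ n
1+∣∁⁅x⁆∣≡n {suc n} x = cong suc (trans (∣∁p∣≡n∸∣p∣ ⁅ x ⁆) (cong (suc n ∸_) (∣⁅x⁆∣≡1 x)))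

x≢y⇒2+∣∁⁅x⁆∩∁⁅y⁆∣≡n : ∀ {n} {x y : Fin n} → x ≢ y → 2 + ∣ ∁ ⁅ x ⁆ ∩ ∁ ⁅ y ⁆ ∣ ≡ n
x≢y⇒2+∣∁⁅x⁆∩∁⁅y⁆∣≡n {x = zero} {zero} x≢y = contradiction refl x≢y
x≢y⇒2+∣∁⁅x⁆∩∁⁅y⁆∣≡n {x = zero} {suc y} _ =
  cong suc (trans (cong suc (∣∁⊥∩p∣≡∣p∣ (∁ ⁅ y ⁆))) (1+∣∁⁅x⁆∣≡n y))
x≢y⇒2+∣∁⁅x⁆∩∁⁅y⁆∣≡n {x = suc x} {zero} _ =
  cong suc (trans (cong suc (∣p∩∁⊥∣≡∣p∣ (∁ ⁅ x ⁆))) (1+∣∁⁅x⁆∣≡n x))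
x≢y⇒2+∣∁⁅x⁆∩∁⁅y⁆∣≡n {x = suc x} {suc y} x≢y = cong suc (x≢y⇒2+∣∁⁅x⁆∩∁⁅y⁆∣≡n (x≢y ∘ cong suc))

x≢y⇒∣∁⁅x⁆∩⁅y⁆∣≡1 : ∀ {n} {x y : Fin n} → x ≢ y → ∣ ∁ ⁅ x ⁆ ∩ ⁅ y ⁆ ∣ ≡ 1
x≢y⇒∣∁⁅x⁆∩⁅y⁆∣≡1 {x = zero} {zero} x≢y = contradiction refl x≢y
x≢y⇒∣∁⁅x⁆∩⁅y⁆∣≡1 {x = zero} {suc y} _ = trans (∣∁⊥∩p∣≡∣p∣ ⁅ y ⁆) (∣⁅x⁆∣≡1 y)
x≢y⇒∣∁⁅x⁆∩⁅y⁆∣≡1 {suc n} {x = suc x} {zero} _ = cong suc (trans (cong ∣_∣ (∩-zeroʳ (∁ ⁅ x ⁆))) (∣⊥∣≡0 n))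
x≢y⇒∣∁⁅x⁆∩⁅y⁆∣≡1 {x = suc x} {suc y} x≢y = x≢y⇒∣∁⁅x⁆∩⁅y⁆∣≡1 (x≢y ∘ cong suc)

complementFamily : ∀ t r → TriangularFamily (Holds (ETHR (2 + t + r) t)) (2 + t)
complementFamily t r =
  tabulate F , length-tabulate F ,
  All.tabulate⁺ {f = F} diagonal , AllPairs.tabulate⁺ {f = F} off-diagonal
  where
  S : Fin (2 + t) → Subset (2 + t + r)
  S i = ∁ ⁅ i ⁆ ++ ⊥
  F : Fin (2 + t) → Subset (2 + t + r) × Subset (2 + t + r)
  F i = S i , S i
  ∣Sᵢ∩Sⱼ∣ : ∀ i j → ∣ S i ∩ S j ∣ ≡ ∣ ∁ ⁅ i ⁆ ∩ ∁ ⁅ j ⁆ ∣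
  ∣Sᵢ∩Sⱼ∣ i j = begin
    ∣ S i ∩ S j ∣                         ≡⟨ ∣p++q∩r++s∣≡∣p∩r∣+∣q∩s∣ (∁ ⁅ i ⁆) ⊥ (∁ ⁅ j ⁆) ⊥ ⟩
    ∣ ∁ ⁅ i ⁆ ∩ ∁ ⁅ j ⁆ ∣ + ∣ ⊥ {r} ∩ ⊥ ∣  ≡⟨ cong (_+_ ∣ ∁ ⁅ i ⁆ ∩ ∁ ⁅ j ⁆ ∣) (cong ∣_∣ (∩-zeroʳ (⊥ {r}))) ⟩
    ∣ ∁ ⁅ i ⁆ ∩ ∁ ⁅ j ⁆ ∣ + ∣ ⊥ {r} ∣      ≡⟨ cong (_+_ ∣ ∁ ⁅ i ⁆ ∩ ∁ ⁅ j ⁆ ∣) (∣⊥∣≡0 r) ⟩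
    ∣ ∁ ⁅ i ⁆ ∩ ∁ ⁅ j ⁆ ∣ + 0             ≡⟨ +-identityʳ _ ⟩
    ∣ ∁ ⁅ i ⁆ ∩ ∁ ⁅ j ⁆ ∣                 ∎
    where open ≡-Reasoning
  diagonal : ∀ i → ¬ Holds (ETHR (2 + t + r) t) (S i) (S i)
  diagonal i holds = 1+n≢n (trans (sym (1+∣∁⁅x⁆∣≡n i)) (cong suc ∣∁⁅i⁆∣≡t))
    where
    ∣∁⁅i⁆∣≡t : ∣ ∁ ⁅ i ⁆ ∣ ≡ t
    ∣∁⁅i⁆∣≡t = trans (sym (trans (∣Sᵢ∩Sⱼ∣ i i) (cong ∣_∣ (∩-idem (∁ ⁅ i ⁆))))) (≡ᵇ⇒≡ _ _ holds)
  off-diagonal : ∀ {i j} → i ≢ j → Holds (ETHR (2 + t + r) t) (S i) (S j)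
  off-diagonal {i} {j} i≢j = ≡⇒≡ᵇ _ _ (trans (∣Sᵢ∩Sⱼ∣ i j) (+-cancelˡ-≡ 2 _ _ (x≢y⇒2+∣∁⁅x⁆∩∁⁅y⁆∣≡n i≢j)))

prefixFamily : ∀ t s → TriangularFamily (Holds (ETHR (t + s) (suc t))) (suc s)
prefixFamily t s =
  (prefix ++ ⊤ , prefix ++ ⊥) ∷ tabulate G , cong suc (length-tabulate G) ,
  (fails ⊤ ⊥ (trans (cong ∣_∣ (∩-zeroʳ (⊤ {s}))) (∣⊥∣≡0 s))
     ∷ All.tabulate⁺ {f = G} (λ i → fails _ _ (trans (cong ∣_∣ (∩-inverseˡ ⁅ i ⁆)) (∣⊥∣≡0 s)))) ,
  (All.tabulate⁺ {f = G} (λ j → holds ⊤ _ (trans (cong ∣_∣ (∩-identityˡ ⁅ j ⁆)) (∣⁅x⁆∣≡1 j)))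
     ∷ AllPairs.tabulate⁺ {f = G} (λ i≢j → holds _ _ (x≢y⇒∣∁⁅x⁆∩⁅y⁆∣≡1 i≢j)))
  where
  prefix : Subset t
  prefix = ⊤
  G : Fin s → Subset (t + s) × Subset (t + s)
  G i = prefix ++ ∁ ⁅ i ⁆ , prefix ++ ⁅ i ⁆
  ∣prefix++p∩prefix++q∣ : ∀ (p q : Subset s) → ∣ (prefix ++ p) ∩ (prefix ++ q) ∣ ≡ t + ∣ p ∩ q ∣
  ∣prefix++p∩prefix++q∣ p q = trans (∣p++q∩r++s∣≡∣p∩r∣+∣q∩s∣ prefix p prefix q)
    (cong (_+ ∣ p ∩ q ∣) (trans (cong ∣_∣ (∩-idem prefix)) (∣⊤∣≡n t)))
  holds : ∀ p q → ∣ p ∩ q ∣ ≡ 1 → Holds (ETHR (t + s) (suc t)) (prefix ++ p) (prefix ++ q)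
  holds p q ∣p∩q∣≡1 =
    ≡⇒≡ᵇ _ _ (trans (∣prefix++p∩prefix++q∣ p q) (trans (cong (t +_) ∣p∩q∣≡1) (+-comm t 1)))
  fails : ∀ p q → ∣ p ∩ q ∣ ≡ 0 → ¬ Holds (ETHR (t + s) (suc t)) (prefix ++ p) (prefix ++ q)
  fails p q ∣p∩q∣≡0 h = 1+n≢n (begin
    suc t                                 ≡⟨ sym (≡ᵇ⇒≡ _ _ h) ⟩
    ∣ (prefix ++ p) ∩ (prefix ++ q) ∣     ≡⟨ ∣prefix++p∩prefix++q∣ p q ⟩
    t + ∣ p ∩ q ∣                         ≡⟨ cong (t +_) ∣p∩q∣≡0 ⟩
    t + 0                                 ≡⟨ +-identityʳ t ⟩
    t                                     ∎)
    where open ≡-Reasoning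

ETHR-triangular[t+2] : ∀ {m t} → t + 2 ≤ m → TriangularFamily (Holds (ETHR m t)) (t + 2)
ETHR-triangular[t+2] {m} {t} t+2≤m =
  subst₂ (λ m k → TriangularFamily (Holds (ETHR m t)) k) (m+[n∸m]≡n 2+t≤m) (+-comm 2 t)
    (complementFamily t (m ∸ (2 + t)))
  where
  2+t≤m : 2 + t ≤ m
  2+t≤m = subst (_≤ m) (+-comm t 2) t+2≤m

ETHR-triangular[m∸t+2] : ∀ {m t} → 1 ≤ t → t ≤ m → TriangularFamily (Holds (ETHR m t)) (m ∸ t + 2)
ETHR-triangular[m∸t+2] {m} {suc t} _ t<m =
  subst₂ (λ m k → TriangularFamily (Holds (ETHR m (suc t))) k)
    (trans (+-suc t _) (m+[n∸m]≡n t<m)) (+-comm 2 (m ∸ suc t))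
    (prefixFamily t (suc (m ∸ suc t)))

m+n≤2*[m⊔n] : ∀ m n → m + n ≤ 2 * (m ⊔ n)
m+n≤2*[m⊔n] m n =
  subst (m + n ≤_) (cong (m ⊔ n +_) (sym (+-identityʳ (m ⊔ n)))) (+-mono-≤ (m≤m⊔n m n) (m≤n⊔m m n))

mainTheorem8 : (n t k q : ℕ) → 3 ≤ n → 1 ≤ t → t ≤ n ∸ 2 → 1 ≤ k →
    (Σ (List ℕ) λ ps → All Prime ps × Unique ps × length ps ≡ k × product ps ≡ q) →
    ∀ ℓ → IPEncoding (ETHR n t) q ℓ →
    (((n ∸ t) + 2) ⊔ (t + 2) ≤ k * ℓ) × (n + 4 ≤ 2 * (((n ∸ t) + 2) ⊔ (t + 2)))
mainTheorem8 n t k q 3≤n 1≤t t≤n∸2 _ (ps , primes , unique , refl , refl) ℓ encoding =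
  ⊔-lub (bound (ETHR-triangular[m∸t+2] 1≤t t≤n)) (bound (ETHR-triangular[t+2] t+2≤n)) ,
  subst (_≤ 2 * ((n ∸ t + 2) ⊔ (t + 2))) sizes (m+n≤2*[m⊔n] (n ∸ t + 2) (t + 2))
  where
  bound : ∀ {size} → TriangularFamily (Holds (ETHR n t)) size → size ≤ length ps * ℓ
  bound (L , refl , triangular) = IPEncoding⇒length≤ primes unique encoding L triangular
  t+2≤n : t + 2 ≤ n
  t+2≤n = m≤o∸n⇒m+n≤o t (≤-trans (s≤s (s≤s z≤n)) 3≤n) t≤n∸2
  t≤n : t ≤ n
  t≤n = m+n≤o⇒m≤o t t+2≤n
  sizes : n ∸ t + 2 + (t + 2) ≡ n + 4
  sizes = trans (rearrange (n ∸ t) t) (cong (_+ 4) (m∸n+n≡m t≤n))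
    where
    rearrange : ∀ a b → a + 2 + (b + 2) ≡ a + b + 4
    rearrange = ℕ-Solver.solve-∀
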